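{- For positive integers $n\ge 2r$, \[\alpha(H_{n:r})\ge r\binom{n-1}{r}=(n-r)\binom{n-1}{r-1}.\]
   Context: For positive integers $n,r$ write $[n]=\{1,\dots,n\}$. The Häggkvist–Hell graph $H_{n:r}$ is the graph whose vertices are the ordered pairs $(h,T)$ where $T$ is an $r$-element subset of $[n]$ and $h\in[n]\setminus T$; two vertices $(h_x,T_x)$ and $(h_y,T_y)$ are adjacent iff $h_x\in T_y$, $h_y\in T_x$ and $T_x\cap T_y=\varnothing$. $\alpha$ denotes the independence number. -}

module Defs where

open import Data.Nat using (ℕ)
open import Data.Fin using (Fin)
open import Data.Fin.Subset using (Subset; _∈_; _∉_; ∣_∣; _∩_; Empty)
open import Data.Product using (_×_; _,_; proj₁; proj₂)
open import Data.List using (List)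
open import Data.List.Relation.Unary.All using (All)
open import Data.List.Relation.Unary.AllPairs using (AllPairs)
open import Data.List.Relation.Unary.Unique.Propositional using (Unique)
open import Relation.Binary.PropositionalEquality using (_≡_)
open import Relation.Nullary using (¬_)

-- A candidate vertex of H_{n:r}: a pair (h , T) with h ∈ [n], T ⊆ [n].
Pair : ℕ → Set
Pair n = Fin n × Subset n

IsVertex : (n r : ℕ) → Pair n → Set
IsVertex n r (h , T) = (∣ T ∣ ≡ r) × (h ∉ T)

Adjacent : {n : ℕ} → Pair n → Pair n → Set
Adjacent (hx , Tx) (hy , Ty) = (hx ∈ Ty) × (hy ∈ Tx) × Empty (Tx ∩ Ty)

IsIndependentSet : (n r : ℕ) → List (Pair n) → Set
IsIndependentSet n r S =
  All (IsVertex n r) S × Unique S × AllPairs (λ x y → ¬ Adjacent x y) S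

module Submission where

-- Fix the element 0 of [n] = [suc m] (r = suc k).
-- Every vertex (h , T) with 0 ∈ T is non-adjacent to every other such
-- vertex, because adjacency forces the two sets to be disjoint.  These
-- vertices are exactly (suc h , {0} ∪ (suc U)) with U a k-subset of [m]
-- and h ∉ U, so there are (m ∸ k) · C(m,k) of them.
--
-- The star is assembled as a
-- concatMap over the k-subsets; the main theorem reads off its
-- independence and size, the size being r · C(n-1,r) by the identity.

open import Defs
open import Data.Nat using (ℕ; zero; suc; _≤_; _+_; _*_; _∸_)
open import Data.Nat.Properties
  using (+-comm; +-suc; +-assoc; *-comm; *-zeroʳ; *-identityˡ; *-identityʳ;
         *-distribˡ-+; *-distribʳ-∸; m+n∸m≡n; m+n∸n≡m; ≤-reflexive)
open import Data.Nat.Combinatorics using (_C_; nC1≡n; nCk+nC[k+1]≡[n+1]C[k+1])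
open import Data.Fin using (Fin; zero; suc)
import Data.Fin.Properties as Fin
open import Data.Fin.Subset using (Subset; ⊥; ∣_∣; _∉_; _∩_; Nonempty) renaming (_∈_ to _∈ₛ_)
open import Data.Fin.Subset.Properties using (∣⊥∣≡0; x∈p∩q⁺)
open import Data.Bool using (true; false)
open import Data.Vec using ([]; _∷_; here; there; tail)
open import Function using (_∘_)
open import Data.Vec.Properties using (∷-injectiveʳ)
open import Data.Product using (_×_; _,_; ∃; proj₁; proj₂)
open import Data.List using (List; []; _∷_; [_]; _++_; map; concatMap; length)
open import Data.List.Properties using (length-map; length-++)
open import Data.List.Membership.Propositional using (_∈_)
open import Data.List.Membership.Propositional.Properties using (∈-map⁻)
open import Data.List.Relation.Unary.All as All using (All; []; _∷_)
import Data.List.Relation.Unary.All.Properties as AllProperties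
open import Data.List.Relation.Unary.AllPairs as AllPairs using (AllPairs; []; _∷_)
import Data.List.Relation.Unary.AllPairs.Properties as AllPairsProperties
open import Data.List.Relation.Unary.Unique.Propositional using (Unique)
import Data.List.Relation.Unary.Unique.Propositional.Properties as UniqueProperties
open import Relation.Binary.PropositionalEquality
  using (_≡_; refl; sym; trans; cong; cong₂; module ≡-Reasoning)
open import Relation.Nullary using (¬_)

sharedElement⇒nonAdjacent : ∀ {n} {x y : Pair n} →
  Nonempty (proj₂ x ∩ proj₂ y) → ¬ Adjacent x y
sharedElement⇒nonAdjacent shared (_ , _ , disjoint) = disjoint shared

commonElement⇒nonAdjacent : ∀ {n} (c : Fin n) {S : List (Pair n)} →
  All (λ v → c ∈ₛ proj₂ v) S → AllPairs (λ x y → ¬ Adjacent x y) S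
commonElement⇒nonAdjacent c [] = []
commonElement⇒nonAdjacent c (c∈x ∷ cs) =
  All.map (λ c∈y → sharedElement⇒nonAdjacent (c , x∈p∩q⁺ (c∈x , c∈y))) cs
  ∷ commonElement⇒nonAdjacent c cs

length-concatMap-const : ∀ {A B : Set} (f : A → List B) (c : ℕ) {xs : List A} →
  All (λ x → length (f x) ≡ c) xs → length (concatMap f xs) ≡ length xs * c
length-concatMap-const f c [] = refl
length-concatMap-const f c {x ∷ xs} (fx≡c ∷ rest) = begin
  length (f x ++ concatMap f xs)         ≡⟨ length-++ (f x) ⟩
  length (f x) + length (concatMap f xs) ≡⟨ cong₂ _+_ fx≡c (length-concatMap-const f c rest) ⟩
  c + length xs * c                      ∎
  where open ≡-Reasoning

concatMap-unique : ∀ {A B : Set} (f : A → List B) (key : B → A) →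
  (∀ x → All (λ b → key b ≡ x) (f x)) → (∀ x → Unique (f x)) →
  {xs : List A} → Unique xs → Unique (concatMap f xs)
concatMap-unique f key keyed unique-f unique-xs =
  UniqueProperties.concat⁺ (AllProperties.map⁺ (All.universal unique-f _))
                           (AllPairsProperties.map⁺ (AllPairs.map disjoint unique-xs))
  where
  disjoint : ∀ {x y} → ¬ x ≡ y → ∀ {b} → ¬ (b ∈ f x × b ∈ f y)
  disjoint {x} {y} x≢y (b∈fx , b∈fy) =
    x≢y (trans (sym (All.lookup (keyed x) b∈fx)) (All.lookup (keyed y) b∈fy))

subsetsOfSize : (m k : ℕ) → List (Subset m)
subsetsOfSize m zero = [ ⊥ ]
subsetsOfSize zero (suc k) = []
subsetsOfSize (suc m) (suc k) =
  map (false ∷_) (subsetsOfSize m (suc k)) ++ map (true ∷_) (subsetsOfSize m k)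

subsetsOfSize-size : ∀ m k → All (λ U → ∣ U ∣ ≡ k) (subsetsOfSize m k)
subsetsOfSize-size m zero = ∣⊥∣≡0 m ∷ []
subsetsOfSize-size zero (suc k) = []
subsetsOfSize-size (suc m) (suc k) =
  AllProperties.++⁺ (AllProperties.map⁺ (subsetsOfSize-size m (suc k)))
                    (AllProperties.map⁺ (All.map (cong suc) (subsetsOfSize-size m k)))

subsetsOfSize-unique : ∀ m k → Unique (subsetsOfSize m k)
subsetsOfSize-unique m zero = [] ∷ []
subsetsOfSize-unique zero (suc k) = []
subsetsOfSize-unique (suc m) (suc k) =
  UniqueProperties.++⁺ (UniqueProperties.map⁺ ∷-injectiveʳ (subsetsOfSize-unique m (suc k)))
                       (UniqueProperties.map⁺ ∷-injectiveʳ (subsetsOfSize-unique m k))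
                       differentHeads
  where
  differentHeads : ∀ {U} → ¬ (U ∈ map (false ∷_) (subsetsOfSize m (suc k))
                              × U ∈ map (true ∷_) (subsetsOfSize m k))
  differentHeads (U∈absent , U∈present)
    with ∈-map⁻ (false ∷_) U∈absent | ∈-map⁻ (true ∷_) U∈present
  ... | _ , _ , refl | _ , _ , ()

length-subsetsOfSize : ∀ m k → length (subsetsOfSize m k) ≡ m C k
length-subsetsOfSize m zero = refl
length-subsetsOfSize zero (suc k) = refl
length-subsetsOfSize (suc m) (suc k) = begin
  length (map (false ∷_) (subsetsOfSize m (suc k)) ++ map (true ∷_) (subsetsOfSize m k))
    ≡⟨ length-++ (map (false ∷_) (subsetsOfSize m (suc k))) ⟩
  length (map (false ∷_) (subsetsOfSize m (suc k))) + length (map (true ∷_) (subsetsOfSize m k))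
    ≡⟨ cong₂ _+_ (length-map _ (subsetsOfSize m (suc k))) (length-map _ (subsetsOfSize m k)) ⟩
  length (subsetsOfSize m (suc k)) + length (subsetsOfSize m k)
    ≡⟨ cong₂ _+_ (length-subsetsOfSize m (suc k)) (length-subsetsOfSize m k) ⟩
  m C suc k + m C k
    ≡⟨ +-comm (m C suc k) (m C k) ⟩
  m C k + m C suc k
    ≡⟨ nCk+nC[k+1]≡[n+1]C[k+1] m k ⟩
  suc m C suc k ∎
  where open ≡-Reasoning

suc-∉ : ∀ {m} {b} {p : Subset m} {h : Fin m} → h ∉ p → suc h ∉ b ∷ p
suc-∉ h∉p (there h∈p) = h∉p h∈p

nonMembers : ∀ {m} → Subset m → List (Fin m)
nonMembers [] = []
nonMembers (true ∷ p) = map suc (nonMembers p)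
nonMembers (false ∷ p) = zero ∷ map suc (nonMembers p)

nonMembers-∉ : ∀ {m} (p : Subset m) → All (_∉ p) (nonMembers p)
nonMembers-∉ [] = []
nonMembers-∉ (true ∷ p) = AllProperties.map⁺ (All.map suc-∉ (nonMembers-∉ p))
nonMembers-∉ (false ∷ p) = (λ ()) ∷ AllProperties.map⁺ (All.map suc-∉ (nonMembers-∉ p))

nonMembers-unique : ∀ {m} (p : Subset m) → Unique (nonMembers p)
nonMembers-unique [] = []
nonMembers-unique (true ∷ p) = UniqueProperties.map⁺ Fin.suc-injective (nonMembers-unique p)
nonMembers-unique (false ∷ p) =
  AllProperties.map⁺ (All.universal (λ _ ()) _)
  ∷ UniqueProperties.map⁺ Fin.suc-injective (nonMembers-unique p)

length-nonMembers : ∀ {m} (p : Subset m) → length (nonMembers p) + ∣ p ∣ ≡ m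
length-nonMembers [] = refl
length-nonMembers {suc m} (true ∷ p) = begin
  length (map suc (nonMembers p)) + suc ∣ p ∣ ≡⟨ cong (_+ suc ∣ p ∣) (length-map suc (nonMembers p)) ⟩
  length (nonMembers p) + suc ∣ p ∣           ≡⟨ +-suc (length (nonMembers p)) ∣ p ∣ ⟩
  suc (length (nonMembers p) + ∣ p ∣)         ≡⟨ cong suc (length-nonMembers p) ⟩
  suc m                                       ∎
  where open ≡-Reasoning
length-nonMembers {suc m} (false ∷ p) = begin
  suc (length (map suc (nonMembers p)) + ∣ p ∣) ≡⟨ cong (λ l → suc (l + ∣ p ∣)) (length-map suc (nonMembers p)) ⟩
  suc (length (nonMembers p) + ∣ p ∣)           ≡⟨ cong suc (length-nonMembers p) ⟩
  suc m                                         ∎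
  where open ≡-Reasoning

absorption : ∀ m k → suc k * (suc m C suc k) ≡ suc m * (m C k)
absorption zero zero = refl
absorption zero (suc k) = *-zeroʳ (suc (suc k))
absorption (suc m) zero = begin
  1 * (suc (suc m) C 1) ≡⟨ *-identityˡ (suc (suc m) C 1) ⟩
  suc (suc m) C 1       ≡⟨ nC1≡n (suc (suc m)) ⟩
  suc (suc m)           ≡⟨ *-identityʳ (suc (suc m)) ⟨
  suc (suc m) * 1       ∎
  where open ≡-Reasoning
absorption (suc m) (suc k) = begin
  suc (suc k) * (suc (suc m) C suc (suc k))
    ≡⟨ cong (suc (suc k) *_) (nCk+nC[k+1]≡[n+1]C[k+1] (suc m) (suc k)) ⟨
  suc (suc k) * (a + b)
    ≡⟨ *-distribˡ-+ (suc (suc k)) a b ⟩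
  (a + suc k * a) + suc (suc k) * b
    ≡⟨ cong₂ (λ x y → (a + x) + y) (absorption m k) (absorption m (suc k)) ⟩
  (a + suc m * (m C k)) + suc m * (m C suc k)
    ≡⟨ +-assoc a (suc m * (m C k)) (suc m * (m C suc k)) ⟩
  a + (suc m * (m C k) + suc m * (m C suc k))
    ≡⟨ cong (a +_) (*-distribˡ-+ (suc m) (m C k) (m C suc k)) ⟨
  a + suc m * (m C k + m C suc k)
    ≡⟨ cong (λ x → a + suc m * x) (nCk+nC[k+1]≡[n+1]C[k+1] m k) ⟩
  suc (suc m) * a ∎
  where
  open ≡-Reasoning
  a = suc m C suc k
  b = suc m C suc (suc k)

-- (k+1) C(m,k+1) = (m ∸ k) C(m,k): subtract (k+1) C(m,k) from both sides of
-- absorption after splitting C(m+1,k+1) by Pascal.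
binomial-step : ∀ m k → suc k * (m C suc k) ≡ (m ∸ k) * (m C k)
binomial-step m k = begin
  suc k * (m C suc k)                              ≡⟨ m+n∸m≡n (suc k * (m C k)) _ ⟨
  suc k * (m C k) + suc k * (m C suc k) ∸ suc k * (m C k)
    ≡⟨ cong (_∸ suc k * (m C k)) (*-distribˡ-+ (suc k) (m C k) (m C suc k)) ⟨
  suc k * (m C k + m C suc k) ∸ suc k * (m C k)
    ≡⟨ cong (λ x → suc k * x ∸ suc k * (m C k)) (nCk+nC[k+1]≡[n+1]C[k+1] m k) ⟩
  suc k * (suc m C suc k) ∸ suc k * (m C k)        ≡⟨ cong (_∸ suc k * (m C k)) (absorption m k) ⟩
  suc m * (m C k) ∸ suc k * (m C k)                ≡⟨ *-distribʳ-∸ (m C k) (suc m) (suc k) ⟨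
  (m ∸ k) * (m C k)                                ∎
  where open ≡-Reasoning

-- For a k-subset U of [m], the vertices (suc h , {0} ∪ suc U) of
-- H_{m+1:k+1}, one for each h ∉ U.
starFibre : ∀ m → Subset m → List (Pair (suc m))
starFibre m U = map (λ h → suc h , true ∷ U) (nonMembers U)

star : (m k : ℕ) → List (Pair (suc m))
star m k = concatMap (starFibre m) (subsetsOfSize m k)

starFibre-vertex : ∀ {m k} {U : Subset m} → ∣ U ∣ ≡ k →
  All (IsVertex (suc m) (suc k)) (starFibre m U)
starFibre-vertex {U = U} size = AllProperties.map⁺ (All.map vertex (nonMembers-∉ U))
  where
  vertex : ∀ {h} → h ∉ U → IsVertex _ _ (suc h , true ∷ U)
  vertex h∉U = cong suc size , suc-∉ h∉U

starFibre-∋0 : ∀ {m} (U : Subset m) → All (λ v → zero ∈ₛ proj₂ v) (starFibre m U)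
starFibre-∋0 U = AllProperties.map⁺ (All.universal (λ _ → here) _)

starFibre-tag : ∀ {m} (U : Subset m) → All (λ v → tail (proj₂ v) ≡ U) (starFibre m U)
starFibre-tag U = AllProperties.map⁺ (All.universal (λ _ → refl) _)

starFibre-unique : ∀ {m} (U : Subset m) → Unique (starFibre m U)
starFibre-unique U = UniqueProperties.map⁺ (Fin.suc-injective ∘ cong proj₁) (nonMembers-unique U)

length-starFibre : ∀ {m k} {U : Subset m} → ∣ U ∣ ≡ k → length (starFibre m U) ≡ m ∸ k
length-starFibre {m} {k} {U} size = begin
  length (starFibre m U)                   ≡⟨ length-map _ (nonMembers U) ⟩
  length (nonMembers U)                    ≡⟨ m+n∸n≡m (length (nonMembers U)) ∣ U ∣ ⟨
  length (nonMembers U) + ∣ U ∣ ∸ ∣ U ∣     ≡⟨ cong₂ _∸_ (length-nonMembers U) size ⟩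
  m ∸ k                                    ∎
  where open ≡-Reasoning

star-independent : ∀ m k → IsIndependentSet (suc m) (suc k) (star m k)
star-independent m k =
  AllProperties.concat⁺ (AllProperties.map⁺ (All.map starFibre-vertex (subsetsOfSize-size m k))) ,
  concatMap-unique (starFibre m) (tail ∘ proj₂) starFibre-tag starFibre-unique
    (subsetsOfSize-unique m k) ,
  commonElement⇒nonAdjacent zero
    (AllProperties.concat⁺ (AllProperties.map⁺ (All.universal starFibre-∋0 (subsetsOfSize m k))))

length-star : ∀ m k → length (star m k) ≡ (m ∸ k) * (m C k)
length-star m k = begin
  length (star m k)
    ≡⟨ length-concatMap-const (starFibre m) (m ∸ k)
         (All.map (λ {U} → length-starFibre {U = U}) (subsetsOfSize-size m k)) ⟩
  length (subsetsOfSize m k) * (m ∸ k) ≡⟨ cong (_* (m ∸ k)) (length-subsetsOfSize m k) ⟩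
  (m C k) * (m ∸ k)                    ≡⟨ *-comm (m C k) (m ∸ k) ⟩
  (m ∸ k) * (m C k)                    ∎
  where open ≡-Reasoning

mainTheorem9 : (n r : ℕ) → 1 ≤ r → r * 2 ≤ n →
    (∃ λ (S : List (Pair n)) → IsIndependentSet n r S × (r * ((n ∸ 1) C r) ≤ length S))
    × (r * ((n ∸ 1) C r) ≡ (n ∸ r) * ((n ∸ 1) C (r ∸ 1)))
mainTheorem9 zero (suc k) _ ()
mainTheorem9 (suc m) (suc k) _ _ =
  (star m k , star-independent m k , ≤-reflexive sizeOfStar) , binomial-step m k
  where
  sizeOfStar : suc k * (m C suc k) ≡ length (star m k)
  sizeOfStar = trans (binomial-step m k) (sym (length-star m k))
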